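{- Let $\mathcal{S}$ be a $\{\mathrm{D},\mathrm{R},*\}$-structure and $s,t\in\mathcal{S}$ with $s\preceq t$. Then for every representation $\theta$ of $\mathcal{S}$ we have $s^\theta\sqsubseteq t^\theta$.
   Context: For relations $R,S$ on a set $X$: $\mathrm{D}(R)=\{(x,x)\mid\exists y\,(x,y)\in R\}$, $\mathrm{R}(R)=\{(y,y)\mid\exists x\,(x,y)\in R\}$, $R;S=\{(x,z)\mid\exists y\,((x,y)\in R\wedge(y,z)\in S)\}$, demonic composition $R*S=\{(x,y)\in R;S\mid\forall z\,((x,z)\in R\Rightarrow(z,z)\in\mathrm{D}(S))\}$. A representation of a $\{\mathrm{D},\mathrm{R},*\}$-structure $\mathcal{S}$ is an isomorphism $\theta$ from $\mathcal{S}$ onto a set of binary relations on some base $X$ closed under $\mathrm{D},\mathrm{R},*$ with these relational interpretations; $s^\theta$ denotes the image of $s$. Demonic refinement: $R\sqsubseteq S$ iff $\mathrm{D}(S)\subseteq\mathrm{D}(R)$ and $\mathrm{D}(S);R\subseteq S$. Define predicates on $\mathcal{S}$: $s\preceq_1 t$ iff there exist $u,v\in\mathcal{S}$ with $\mathrm{D}(u*v)=u*v$, $s=\mathrm{R}(u*\mathrm{D}(v))$ and $t=s*v*u$; $s\preceq_{n+1}t$ iff either there exist $s',t',u,v$ with $s'\preceq_n t'$, $s=u*s'*v$, $t=u*t'*v$, or there exists $v$ with $s\preceq_n v$ and $v\preceq_n t$; and $\preceq=\bigcup_{n\ge 1}\preceq_n$. (Iterated products such as $s*v*u$ are written without brackets;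 in any representable structure $*$ is associative.) -}

module Defs where

open import Level using (Level; _⊔_; suc)
open import Data.Nat using (ℕ; zero) renaming (suc to 1+)
open import Data.Product using (Σ; ∃; ∃-syntax; _×_; _,_)
open import Data.Sum using (_⊎_)
open import Relation.Binary.PropositionalEquality using (_≡_)

record DRStar (c : Level) : Set (suc c) where
  field
    Carrier : Set c
    D R     : Carrier → Carrier
    _*_     : Carrier → Carrier → Carrier
  infixl 7 _*_

Rel : ∀ {ℓ} → Set ℓ → Set (suc ℓ)
Rel {ℓ} X = X → X → Set ℓ

module _ {ℓ} {X : Set ℓ} where

  _⊆_ : Rel X → Rel X → Set ℓ
  P ⊆ Q = ∀ x y → P x y → Q x y

  _≐_ : Rel X → Rel X → Set ℓ
  P ≐ Q = (P ⊆ Q) × (Q ⊆ P)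

  Dom : Rel X → Rel X
  Dom P x x' = (x ≡ x') × ∃[ y ] P x y

  Ran : Rel X → Rel X
  Ran P y y' = (y ≡ y') × ∃[ x ] P x y

  _⨾_ : Rel X → Rel X → Rel X
  (P ⨾ Q) x z = ∃[ y ] (P x y × Q y z)

  _⊛_ : Rel X → Rel X → Rel X
  (P ⊛ Q) x y = (P ⨾ Q) x y × (∀ z → P x z → Dom Q z z)

  _⊑_ : Rel X → Rel X → Set ℓ
  P ⊑ Q = (Dom Q ⊆ Dom P) × ((Dom Q ⨾ P) ⊆ Q)

record Representation {c} (S : DRStar c) (ℓ : Level) : Set (c ⊔ suc ℓ) where
  open DRStar S
  field
    Base   : Set ℓ
    θ      : Carrier → Rel Base
    θ-inj  : ∀ s t → θ s ≐ θ t → s ≡ t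
    θ-D    : ∀ s → θ (D s) ≐ Dom (θ s)
    θ-R    : ∀ s → θ (R s) ≐ Ran (θ s)
    θ-*    : ∀ s t → θ (s * t) ≐ (θ s ⊛ θ t)

module _ {c} (S : DRStar c) where
  open DRStar S

  ⪯[_] : ℕ → Carrier → Carrier → Set c
  ⪯[ zero ] s t =
    ∃[ u ] ∃[ v ] (D (u * v) ≡ u * v × s ≡ R (u * D v) × t ≡ s * v * u)
  ⪯[ 1+ n ] s t =
    (∃[ s' ] ∃[ t' ] ∃[ u ] ∃[ v ]
        (⪯[ n ] s' t' × s ≡ u * s' * v × t ≡ u * t' * v))
    ⊎ (∃[ v ] (⪯[ n ] s v × ⪯[ n ] v t))

  _⪯_ : Carrier → Carrier → Set c
  s ⪯ t = ∃[ n ] ⪯[ n ] s t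

-- In any algebra of relations ⊑ is a preorder, respects extensional equality and is
-- monotone on both sides of demonic composition, so the closure rules defining ⪯ are
-- sound and everything reduces to the generating case s = R(u * D v), t = s * v * u.
-- Representing u, v by U, V, the hypothesis D(u * v) = u * v says U ⊛ V is coreflexive.
-- A point a of s comes with some x such that U x a and every U-successor of x is in
-- the domain of V; then every V-successor of a is a (U ⊛ V)-successor of x, hence
-- equals x, so (s * v * u) relates a to itself as soon as a is in its domain.
module Submission where

open import Defs
open import Level using (Level)
open import Data.Nat using (zero) renaming (suc to 1+)
open import Data.Product using (∃-syntax; _×_; _,_; proj₁; proj₂)
open import Data.Sum using (inj₁; inj₂)
open import Relation.Binary.PropositionalEquality using (_≡_; refl; sym; subst)

module _ {ℓ} {X : Set ℓ} where

  Coreflexive : Rel X → Set ℓ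
  Coreflexive P = ∀ x y → P x y → x ≡ y

  ≐-refl : {P : Rel X} → P ≐ P
  ≐-refl = (λ _ _ p → p) , (λ _ _ p → p)

  ≐-sym : {P Q : Rel X} → P ≐ Q → Q ≐ P
  ≐-sym (P⊆Q , Q⊆P) = Q⊆P , P⊆Q

  ≐-trans : {P Q W : Rel X} → P ≐ Q → Q ≐ W → P ≐ W
  ≐-trans (P⊆Q , Q⊆P) (Q⊆W , W⊆Q) =
    (λ x y p → Q⊆W x y (P⊆Q x y p)) , (λ x y w → Q⊆P x y (W⊆Q x y w))

  Dom-mono : {P Q : Rel X} → P ⊆ Q → Dom P ⊆ Dom Q
  Dom-mono P⊆Q x x' (eq , y , p) = eq , y , P⊆Q x y p

  Ran-mono : {P Q : Rel X} → P ⊆ Q → Ran P ⊆ Ran Q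
  Ran-mono P⊆Q y y' (eq , x , p) = eq , x , P⊆Q x y p

  Ran-cong : {P Q : Rel X} → P ≐ Q → Ran P ≐ Ran Q
  Ran-cong (P⊆Q , Q⊆P) = Ran-mono P⊆Q , Ran-mono Q⊆P

  Dom-idem : {P : Rel X} → Dom (Dom P) ⊆ Dom P
  Dom-idem x x' (eq , _ , _ , p) = eq , p

  Dom-coreflexive : (P : Rel X) → Coreflexive (Dom P)
  Dom-coreflexive P x x' (eq , _) = eq

  ⊛-cong-⊆ : {P P' Q Q' : Rel X} → P ≐ P' → Q ≐ Q' → (P ⊛ Q) ⊆ (P' ⊛ Q')
  ⊛-cong-⊆ (P⊆P' , P'⊆P) (Q⊆Q' , _) x z ((y , p , q) , total) =
    (y , P⊆P' x y p , Q⊆Q' y z q) ,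
    λ w p'xw → Dom-mono Q⊆Q' w w (total w (P'⊆P x w p'xw))

  ⊛-cong : {P P' Q Q' : Rel X} → P ≐ P' → Q ≐ Q' → (P ⊛ Q) ≐ (P' ⊛ Q')
  ⊛-cong P≐P' Q≐Q' = ⊛-cong-⊆ P≐P' Q≐Q' , ⊛-cong-⊆ (≐-sym P≐P') (≐-sym Q≐Q')

  ⊑-trans : {P Q W : Rel X} → P ⊑ Q → Q ⊑ W → P ⊑ W
  ⊑-trans (domQ⊆domP , Q⊇P) (domW⊆domQ , W⊇Q) =
    (λ x y w → domQ⊆domP x y (domW⊆domQ x y w)) ,
    λ { x y (_ , (refl , w) , p) →
          W⊇Q x y (x , (refl , w) ,
                   Q⊇P x y (x , domW⊆domQ x x (refl , w) , p)) }

  ⊑-resp-≐ : {P P' Q Q' : Rel X} → P ≐ P' → Q ≐ Q' → P ⊑ Q → P' ⊑ Q'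
  ⊑-resp-≐ (P⊆P' , P'⊆P) (Q⊆Q' , Q'⊆Q) (domQ⊆domP , Q⊇P) =
    (λ x y d → Dom-mono P⊆P' x y (domQ⊆domP x y (Dom-mono Q'⊆Q x y d))) ,
    λ { x y (m , d , p') →
          Q⊆Q' x y (Q⊇P x y (m , Dom-mono Q'⊆Q x m d , P'⊆P m y p')) }

  ⊛-monoʳ-⊑ : {U P Q : Rel X} → P ⊑ Q → (U ⊛ P) ⊑ (U ⊛ Q)
  ⊛-monoʳ-⊑ (domQ⊆domP , Q⊇P) =
    (λ { x x' (eq , z , (y , u , q) , total) →
           let (_ , z' , p) = domQ⊆domP y y (refl , z , q)
           in eq , z' , (y , u , p) , λ w uxw → domQ⊆domP w w (total w uxw) }) ,
    λ { x z (_ , (refl , _ , _ , total) , (y , u , p) , _) →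
          (y , u , Q⊇P y z (y , total y u , p)) , total }

  ⊛-monoˡ-⊑ : {V P Q : Rel X} → P ⊑ Q → (P ⊛ V) ⊑ (Q ⊛ V)
  ⊛-monoˡ-⊑ {V} {P} {Q} (domQ⊆domP , Q⊇P) =
    (λ { x x' (refl , z , (y , q , v) , total) →
           let Q⊇Pₓ : ∀ w → P x w → Q x w
               Q⊇Pₓ w p = Q⊇P x w (x , (refl , y , q) , p)
               (_ , y' , p) = domQ⊆domP x x (refl , y , q)
               (_ , z' , v') = total y' (Q⊇Pₓ y' p)
           in refl , z' , (y' , p , v') , λ w p' → total w (Q⊇Pₓ w p') }) ,
    λ { x z (_ , (refl , _ , (y , q , _) , total) , (y' , p , v) , _) →
          (y' , Q⊇P x y' (x , (refl , y , q) , p) , v) , total }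

  module _ {U V : Rel X} where

    Ran-⊛-Dom⁻ : ∀ a b → Ran (U ⊛ Dom V) a b →
                 a ≡ b × ∃[ x ] (U x a × (∀ z → U x z → Dom V z z))
    Ran-⊛-Dom⁻ a b (eq , x , (_ , u , (refl , _)) , total) =
      eq , x , u , λ z uxz → Dom-idem {P = V} z z (total z uxz)

    Ran-⊛-Dom⁺ : ∀ {a x} → U x a → (∀ z → U x z → Dom V z z) → Ran (U ⊛ Dom V) a a
    Ran-⊛-Dom⁺ {a} {x} u total =
      refl , x , (a , u , total a u) , λ z uxz → refl , z , total z uxz

    coreflexive⇒Ran-⊛-Dom-⊑ : Coreflexive (U ⊛ V) →
      let P = Ran (U ⊛ Dom V) in P ⊑ ((P ⊛ V) ⊛ U)
    coreflexive⇒Ran-⊛-Dom-⊑ U⊛V-corefl = domain , image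
      where
      P : Rel X
      P = Ran (U ⊛ Dom V)

      P-diagonal : ∀ {a b} → P a b → a ≡ b
      P-diagonal {a} {b} p = proj₁ (Ran-⊛-Dom⁻ a b p)

      domain : Dom ((P ⊛ V) ⊛ U) ⊆ Dom P
      domain a a' (eq , _ , (_ , ((m , p , _) , _) , _) , _) = eq , m , p

      image : (Dom ((P ⊛ V) ⊛ U) ⨾ P) ⊆ ((P ⊛ V) ⊛ U)
      image a b (_ , (refl , _ , (_ , ((m , pam , vmw) , _) , _) , _) , pab)
        with Ran-⊛-Dom⁻ a b pab | P-diagonal pam
      ... | refl , x , uxa , total | refl = (x , pvax , uxa) , onlyToX
        where
        V-from-a-to-x : ∀ {z} → V a z → x ≡ z
        V-from-a-to-x {z} vaz = U⊛V-corefl x z ((a , uxa , vaz) , total)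

        vax : V a x
        vax = subst (V a) (sym (V-from-a-to-x vmw)) vmw

        pvax : (P ⊛ V) a x
        pvax = (a , Ran-⊛-Dom⁺ uxa total , vax) ,
               λ z paz → subst (λ k → Dom V k k) (P-diagonal paz) (refl , x , vax)

        onlyToX : ∀ z → (P ⊛ V) a z → Dom U z z
        onlyToX z ((m' , pam' , vm'z) , _) with P-diagonal pam'
        ... | refl = subst (λ k → Dom U k k) (V-from-a-to-x vm'z) (refl , a , uxa)

module _ {c ℓ : Level} (S : DRStar c) (ρ : Representation S ℓ) where
  open DRStar S
  open Representation ρ

  θ-*³ : ∀ a b d → θ (a * b * d) ≐ ((θ a ⊛ θ b) ⊛ θ d)
  θ-*³ a b d = ≐-trans (θ-* (a * b) d) (⊛-cong (θ-* a b) ≐-refl)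

  ⪯-generator-⊑ : ∀ u v → D (u * v) ≡ u * v → θ (R (u * D v)) ⊑ θ (R (u * D v) * v * u)
  ⪯-generator-⊑ u v D[uv]≡uv =
    ⊑-resp-≐ (≐-sym θs≐P)
             (≐-sym (≐-trans (θ-*³ s v u) (⊛-cong (⊛-cong θs≐P ≐-refl) ≐-refl)))
             (coreflexive⇒Ran-⊛-Dom-⊑ U⊛V-coreflexive)
    where
    s : Carrier
    s = R (u * D v)

    θs≐P : θ s ≐ Ran (θ u ⊛ Dom (θ v))
    θs≐P = ≐-trans (θ-R (u * D v)) (Ran-cong (≐-trans (θ-* u (D v)) (⊛-cong ≐-refl (θ-D v))))

    U⊛V-coreflexive : Coreflexive (θ u ⊛ θ v)
    U⊛V-coreflexive x y uv =
      Dom-coreflexive (θ (u * v)) x y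
        (proj₁ (θ-D (u * v)) x y
          (subst (λ e → θ e x y) (sym D[uv]≡uv) (proj₂ (θ-* u v) x y uv)))

  ⪯[]⇒⊑ : ∀ n {s t} → ⪯[_] S n s t → θ s ⊑ θ t
  ⪯[]⇒⊑ zero (u , v , D[uv]≡uv , refl , refl) = ⪯-generator-⊑ u v D[uv]≡uv
  ⪯[]⇒⊑ (1+ n) (inj₁ (s' , t' , u , v , s'⪯t' , refl , refl)) =
    ⊑-resp-≐ (≐-sym (θ-*³ u s' v)) (≐-sym (θ-*³ u t' v))
             (⊛-monoˡ-⊑ (⊛-monoʳ-⊑ (⪯[]⇒⊑ n s'⪯t')))
  ⪯[]⇒⊑ (1+ n) (inj₂ (v , s⪯v , v⪯t)) = ⊑-trans (⪯[]⇒⊑ n s⪯v) (⪯[]⇒⊑ n v⪯t)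

lemma3 : ∀ {c ℓ : Level} (S : DRStar c) (s t : DRStar.Carrier S) → _⪯_ S s t →
           (ρ : Representation S ℓ) →
           Representation.θ ρ s ⊑ Representation.θ ρ t
lemma3 S s t (n , s⪯ₙt) ρ = ⪯[]⇒⊑ S ρ n s⪯ₙt
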